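{- Let $\varepsilon>\eta>0$ and consider a \textsc{Set Cover} instance over a universe of $n$ elements with $n$ cover-sets $S_1,\dots,S_n$ such that every element of the universe appears in exactly $f=(\varepsilon-\eta)n$ cover-sets and there is no feasible solution that uses fewer than $\log_{1+\varepsilon}n$ cover-sets. Let $\ell\ge 0$ be an integer with $f\ge 3\ell$. Then the vector ${\bf y}$ indexed by subsets of $\{1,\dots,n\}$ of size at most $\ell+1$ defined by $$y_A=\frac{(f-\ell-1)!}{(f-\ell-1+|A|)!}\quad\text{for all }A\subseteq\{1,\dots,n\},\ |A|\le \ell+1,$$ satisfies the level-$\ell$ Sherali–Adams LP relaxation of the \textsc{Set Cover} polytope.
   Context: The \textsc{Set Cover} polytope is given by variables $y_1,\dots,y_n$ (one per cover-set) with constraints $\sum_{j:u\in S_j}y_j\ge1$ for each universe element $u$ and $0\le y_j\le 1$ for each $j$. Sherali–Adams relaxation at level $\ell$: given a polytope over $y_1,\dots,y_n$ defined by finitely many linear constraints (including the box constraints $y_j\ge0$ and $-y_j\ge-1$), the level-$\ell$ relaxation is the LP over variables $y_A$ for all $A\subseteq\{1,\dots,n\}$ with $|A|\le\ell+1$, with $y_\emptyset=1$, having, for every original constraint $\sum_j a_jy_j\ge b$ and every pair of disjoint $P,E\subseteq\{1,\dots,n\}$ with $|P|+|E|\le\ell$, the constraint $\sum_{j=1}^n a_j\sum_{T\subseteq E}(-1)^{|T|}y_{P\cup T\cup\{j\}}\ge b\sum_{T\subseteq E}(-1)^{|T|}y_{P\cup T}$.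
   Formalization: The parameters ε and η are taken to be rational numbers. -}

module Defs where

open import Data.Nat as ℕ using (ℕ; zero; suc; _!; _∸_)
open import Data.Nat.Properties using (_!≢0)
open import Data.Integer using (+_)
open import Data.Rational as ℚ using (ℚ; 0ℚ; 1ℚ; _+_; _*_; _/_; _≤_; -_)
open import Data.Fin using (Fin)
open import Data.Fin.Subset using (Subset; inside; outside; _∈_; _∪_; _∩_; ⁅_⁆; ∣_∣; Empty; ⊥)
open import Data.Fin.Subset.Properties using (_∈?_)
open import Data.Vec using (Vec; []; _∷_)
open import Data.List using (List; []; _∷_; [_]; map; _++_; foldr; filter; length; allFin)
open import Data.Product using (_×_; Σ; ∃)
open import Relation.Binary.PropositionalEquality using (_≡_)

sumℚ : List ℚ → ℚ
sumℚ = foldr _+_ 0ℚ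

Σ[Fin] : (n : ℕ) → (Fin n → ℚ) → ℚ
Σ[Fin] n g = sumℚ (map g (allFin n))

_^ℚ_ : ℚ → ℕ → ℚ
q ^ℚ zero  = 1ℚ
q ^ℚ suc k = q * (q ^ℚ k)

ℕ→ℚ : ℕ → ℚ
ℕ→ℚ k = (+ k) / 1

subsetsOf : ∀ {n} → Subset n → List (Subset n)
subsetsOf [] = [ [] ]
subsetsOf (inside ∷ E)  = map (outside ∷_) (subsetsOf E) ++ map (inside ∷_) (subsetsOf E)
subsetsOf (outside ∷ E) = map (outside ∷_) (subsetsOf E)

Disjoint : ∀ {n} → Subset n → Subset n → Set
Disjoint P E = Empty (P ∩ E)

record Constraint (n : ℕ) : Set where
  constructor _≥ᶜ_
  field
    coeff : Fin n → ℚ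
    rhs   : ℚ

altSum : ∀ {n} → (Subset n → ℚ) → Subset n → Subset n → Subset n → ℚ
altSum y P E X = sumℚ (map (λ T → ((- 1ℚ) ^ℚ ∣ T ∣) * y (P ∪ T ∪ X)) (subsetsOf E))

-- The vector y (given on all subsets; only its values on subsets of size ≤ ℓ+1
-- are ever used) satisfies the level-ℓ Sherali–Adams relaxation of the polytope
-- given by the constraint family C (which must include the box constraints).
SA-feasible : ∀ {n} {I : Set} → ℕ → (I → Constraint n) → (Subset n → ℚ) → Set
SA-feasible {n} {I} ℓ C y =
  (y ⊥ ≡ 1ℚ) ×
  (∀ (i : I) (P E : Subset n) → Disjoint P E → ∣ P ∣ ℕ.+ ∣ E ∣ ℕ.≤ ℓ →
     Constraint.rhs (C i) * altSum y P E ⊥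
       ≤ Σ[Fin] n (λ j → Constraint.coeff (C i) j * altSum y P E ⁅ j ⁆))

SetCoverInstance : ℕ → Set
SetCoverInstance n = Fin n → Subset n

data SCIndex (n : ℕ) : Set where
  cover : Fin n → SCIndex n
  lower : Fin n → SCIndex n
  upper : Fin n → SCIndex n

open import Relation.Nullary.Decidable using (does)
open import Data.Bool using (if_then_else_)
open import Data.Fin using (_≟_)

setCoverConstraints : ∀ {n} → SetCoverInstance n → SCIndex n → Constraint n
setCoverConstraints S (cover u) = (λ j → if does (u ∈? S j) then 1ℚ else 0ℚ) ≥ᶜ 1ℚ
setCoverConstraints S (lower k) = (λ j → if does (j ≟ k) then 1ℚ else 0ℚ) ≥ᶜ 0ℚ
setCoverConstraints S (upper k) = (λ j → if does (j ≟ k) then - 1ℚ else 0ℚ) ≥ᶜ (- 1ℚ)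

frequency : ∀ {n} → SetCoverInstance n → Fin n → ℕ
frequency {n} S u = length (filter (λ j → u ∈? S j) (allFin n))

IsCover : ∀ {n} → SetCoverInstance n → Subset n → Set
IsCover {n} S C = ∀ (u : Fin n) → ∃ λ j → j ∈ C × u ∈ S j

yVec : ∀ {n} → ℕ → ℕ → Subset n → ℚ
yVec f ℓ A = _/_ (+ ((f ∸ ℓ ∸ 1) !)) (((f ∸ ℓ ∸ 1) ℕ.+ ∣ A ∣) !) {{((f ∸ ℓ ∸ 1) ℕ.+ ∣ A ∣) !≢0}}

-- The vector depends only on |A|, through h k = m! / (m + k)! with m = f - ℓ - 1.  For disjoint
-- P, E the Sherali–Adams product Σ_{T ⊆ E} (-1)^|T| y_{P ∪ T ∪ X} is then the |E|-th forward
-- difference Δ^|E| h at |P ∪ X|, and it vanishes when X meets E.  From h c = (m + c + 1) h (c + 1)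
-- the differences satisfy Δ^e h c = (m + c + 1) Δ^e h (c + 1) - e Δ^(e-1) h (c + 2), and an
-- induction on e along this recurrence shows Δ^e h c ≥ 0 whenever e ≤ m + c + 1.  Nonnegativity
-- handles the box constraints.  In a cover constraint each of the f sets containing u that lies
-- outside E contributes at least Δ^e h (p + 1), and (f - e) Δ^e h (p + 1) ≥ Δ^e h p by the
-- recurrence as soon as f ≥ m + p + e + 1.  Both index conditions hold because f ≥ 3ℓ, f > 0
-- force m ≥ ℓ.
module Submission where

open import Defs
open import Data.Bool using (Bool; true; false; if_then_else_; _∨_)
open import Data.Fin using (Fin; zero; suc; _≟_)
open import Data.Fin.Subset using (Subset; inside; outside; _∈_; _∉_; _∪_; _∩_; ⁅_⁆; ∣_∣; Empty; ⊥)
open import Data.Fin.Subset.Properties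
  using (_∈?_; drop-∷-Empty; x∈⁅x⁆; x∈⁅y⁆⇒x≡y; x∈p∩q⁻; ∣⊥∣≡0; ∉⊥; ∪-identityʳ)
open import Data.Integer as ℤ using (+_)
import Data.Integer.Properties as ℤP
open import Data.List using (List; []; _∷_; map; _++_; filter; length; allFin)
import Data.List.Properties as ListP
open import Data.Nat as ℕ using (ℕ; zero; suc; _!; _∸_)
import Data.Nat.Properties as ℕP
open import Data.Nat.Properties using (_!≢0)
open import Data.Nat.Coprimality using (1-coprimeTo) renaming (sym to coprime-sym)
open import Data.Product using (_×_; _,_; proj₁; proj₂)
import Data.Rational as ℚ
open import Data.Rational using (ℚ; 0ℚ; 1ℚ; mkℚ; _+_; _*_; _-_; -_; _/_; _≤_; _<_; toℚᵘ)
import Data.Rational.Properties as ℚP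
import Data.Rational.Unnormalised as ℚᵘ
import Data.Rational.Unnormalised.Properties as ℚᵘP
open import Data.Rational.Solver using (module +-*-Solver)
open import Data.Sum using (_⊎_; inj₁; inj₂)
import Data.Sum as Sum
open import Data.Vec using ([]; _∷_; here; there)
open import Function using (_∘_)
open import Relation.Nullary using (Dec; does; yes; no)
open import Relation.Nullary.Negation using (contradiction)
open import Relation.Binary.PropositionalEquality

open +-*-Solver

ℕ→ℚ≡mkℚ : ∀ k → ℕ→ℚ k ≡ mkℚ (+ k) 0 (coprime-sym (1-coprimeTo k))
ℕ→ℚ≡mkℚ k = ℚP.normalize-coprime (coprime-sym (1-coprimeTo k))

ℕ→ℚ-+ : ∀ a b → ℕ→ℚ (a ℕ.+ b) ≡ ℕ→ℚ a + ℕ→ℚ b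
ℕ→ℚ-+ a b = begin
  + (a ℕ.+ b) / 1                    ≡⟨ cong (_/ 1) (trans (ℤP.pos-+ a b) (sym units)) ⟩
  (+ a ℤ.* + 1 ℤ.+ + b ℤ.* + 1) / 1  ≡⟨ sym (cong₂ _+_ (ℕ→ℚ≡mkℚ a) (ℕ→ℚ≡mkℚ b)) ⟩
  ℕ→ℚ a + ℕ→ℚ b                      ∎
  where
  open ≡-Reasoning
  units : + a ℤ.* + 1 ℤ.+ + b ℤ.* + 1 ≡ + a ℤ.+ + b
  units = cong₂ ℤ._+_ (ℤP.*-identityʳ (+ a)) (ℤP.*-identityʳ (+ b))

ℕ→ℚ-suc : ∀ k → ℕ→ℚ (suc k) ≡ 1ℚ + ℕ→ℚ k
ℕ→ℚ-suc = ℕ→ℚ-+ 1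

ℕ→ℚ-nonNeg : ∀ k → 0ℚ ≤ ℕ→ℚ k
ℕ→ℚ-nonNeg k = ℚP.nonNegative⁻¹ _ {{ℚP.normalize-nonNeg k 1}}

toℚᵘ-/ : ∀ i n .{{_ : ℕ.NonZero n}} → toℚᵘ (i / n) ℚᵘ.≃ (i ℚᵘ./ n)
toℚᵘ-/ i (suc n) = ℚP.toℚᵘ-fromℚᵘ (ℚᵘ.mkℚᵘ i n)

n/n≡1 : ∀ n .{{_ : ℕ.NonZero n}} → + n / n ≡ 1ℚ
n/n≡1 n@(suc _) =
  ℚP.toℚᵘ-injective (ℚᵘP.≃-trans (toℚᵘ-/ (+ n) n) (ℚᵘ.*≡* (ℤP.*-comm (+ n) (+ 1))))

i/d≡s*i/[s*d] : ∀ i s d .{{_ : ℕ.NonZero d}} →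
                i / d ≡ ℕ→ℚ (suc s) * (i / (suc s ℕ.* d)) {{ℕP.m*n≢0 (suc s) d}}
i/d≡s*i/[s*d] i s d@(suc _) = ℚP.toℚᵘ-injective (begin
  toℚᵘ (i / d)                                      ≈⟨ toℚᵘ-/ i d ⟩
  i ℚᵘ./ d                                          ≈⟨ ℚᵘP.≃-sym (ℚᵘP.*-cancelˡ-/ (suc s) {i} {d}) ⟩
  (+ suc s ℤ.* i) ℚᵘ./ (suc s ℕ.* d)                ≡⟨ ℚᵘP./-cong refl (sym (ℕP.*-identityˡ (suc s ℕ.* d))) ⟩
  (+ suc s ℚᵘ./ 1) ℚᵘ.* (i ℚᵘ./ (suc s ℕ.* d))      ≈⟨ ℚᵘP.*-cong (ℚᵘP.≃-sym (toℚᵘ-/ (+ suc s) 1))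
                                                                   (ℚᵘP.≃-sym (toℚᵘ-/ i (suc s ℕ.* d))) ⟩
  toℚᵘ (ℕ→ℚ (suc s)) ℚᵘ.* toℚᵘ (i / (suc s ℕ.* d))  ≈⟨ ℚᵘP.≃-sym (ℚP.toℚᵘ-homo-* (ℕ→ℚ (suc s))
                                                                                       (i / (suc s ℕ.* d))) ⟩
  toℚᵘ (ℕ→ℚ (suc s) * (i / (suc s ℕ.* d)))          ∎)
  where open ℚᵘP.≃-Reasoning

≤-from-difference : ∀ {p q} r → q - p ≡ r → 0ℚ ≤ r → p ≤ q
≤-from-difference {p} {q} r q-p≡r 0≤r = begin
  p            ≡⟨ sym (ℚP.+-identityʳ p) ⟩
  p + 0ℚ       ≤⟨ ℚP.+-monoʳ-≤ p (subst (0ℚ ≤_) (sym q-p≡r) 0≤r) ⟩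
  p + (q - p)  ≡⟨ solve 2 (λ p q → p :+ (q :- p) := q) refl p q ⟩
  q            ∎
  where open ℚP.≤-Reasoning

0≤q-p : ∀ {p q} → p ≤ q → 0ℚ ≤ q - p
0≤q-p {p} {q} p≤q = subst (_≤ q - p) (ℚP.+-inverseʳ p) (ℚP.+-monoˡ-≤ (- p) p≤q)

p≤p+q : ∀ {p q} → 0ℚ ≤ q → p ≤ p + q
p≤p+q {p} {q} 0≤q = subst (_≤ p + q) (ℚP.+-identityʳ p) (ℚP.+-monoʳ-≤ p 0≤q)

0≤+ : ∀ {p q} → 0ℚ ≤ p → 0ℚ ≤ q → 0ℚ ≤ p + q
0≤+ = ℚP.+-mono-≤

0≤* : ∀ {p q} → 0ℚ ≤ p → 0ℚ ≤ q → 0ℚ ≤ p * q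
0≤* {p} {q} 0≤p 0≤q =
  ℚP.nonNegative⁻¹ _ {{ℚP.nonNeg*nonNeg⇒nonNeg p {{ℚ.nonNegative 0≤p}} q {{ℚ.nonNegative 0≤q}}}}

p≤[1+k]*p : ∀ {p} k → 0ℚ ≤ p → p ≤ ℕ→ℚ (suc k) * p
p≤[1+k]*p {p} k 0≤p = ≤-from-difference (ℕ→ℚ k * p)
  (trans (cong (λ t → t * p - p) (ℕ→ℚ-suc k))
         (solve 2 (λ k p → (con 1ℚ :+ k) :* p :- p := k :* p) refl (ℕ→ℚ k) p))
  (0≤* (ℕ→ℚ-nonNeg k) 0≤p)

𝟙 : Bool → ℚ
𝟙 b = if b then 1ℚ else 0ℚ

sumℚ-++ : ∀ (xs ys : List ℚ) → sumℚ (xs ++ ys) ≡ sumℚ xs + sumℚ ys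
sumℚ-++ []       ys = sym (ℚP.+-identityˡ (sumℚ ys))
sumℚ-++ (x ∷ xs) ys = trans (cong (_+_ x) (sumℚ-++ xs ys)) (sym (ℚP.+-assoc x (sumℚ xs) (sumℚ ys)))

module _ {A : Set} where

  sumℚ-map-homo : (φ : ℚ → ℚ) → φ 0ℚ ≡ 0ℚ → (∀ p q → φ (p + q) ≡ φ p + φ q) →
                  ∀ (f : A → ℚ) xs → sumℚ (map (φ ∘ f) xs) ≡ φ (sumℚ (map f xs))
  sumℚ-map-homo φ φ0 φ+ f []       = sym φ0
  sumℚ-map-homo φ φ0 φ+ f (x ∷ xs) =
    trans (cong (_+_ (φ (f x))) (sumℚ-map-homo φ φ0 φ+ f xs)) (sym (φ+ (f x) (sumℚ (map f xs))))

  sumℚ-map-*ˡ : ∀ c (f : A → ℚ) xs → sumℚ (map (λ x → c * f x) xs) ≡ c * sumℚ (map f xs)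
  sumℚ-map-*ˡ c = sumℚ-map-homo (c *_) (ℚP.*-zeroʳ c) (ℚP.*-distribˡ-+ c)

  sumℚ-map-*ʳ : ∀ c (f : A → ℚ) xs → sumℚ (map (λ x → f x * c) xs) ≡ sumℚ (map f xs) * c
  sumℚ-map-*ʳ c = sumℚ-map-homo (_* c) (ℚP.*-zeroˡ c) (ℚP.*-distribʳ-+ c)

  sumℚ-map-neg : ∀ (f : A → ℚ) xs → sumℚ (map (λ x → - f x) xs) ≡ - sumℚ (map f xs)
  sumℚ-map-neg = sumℚ-map-homo -_ refl ℚP.neg-distrib-+

  sumℚ-map-- : ∀ (f g : A → ℚ) xs →
               sumℚ (map (λ x → f x - g x) xs) ≡ sumℚ (map f xs) - sumℚ (map g xs)
  sumℚ-map-- f g []       = refl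
  sumℚ-map-- f g (x ∷ xs) = trans (cong (_+_ (f x - g x)) (sumℚ-map-- f g xs))
    (solve 4 (λ a b c d → (a :- b) :+ (c :- d) := (a :+ c) :- (b :+ d)) refl
       (f x) (g x) (sumℚ (map f xs)) (sumℚ (map g xs)))

  sumℚ-map-mono : ∀ {f g : A → ℚ} → (∀ x → f x ≤ g x) → ∀ xs → sumℚ (map f xs) ≤ sumℚ (map g xs)
  sumℚ-map-mono f≤g []       = ℚP.≤-refl
  sumℚ-map-mono f≤g (x ∷ xs) = ℚP.+-mono-≤ (f≤g x) (sumℚ-map-mono f≤g xs)

  sumℚ-map-𝟙 : ∀ {P : A → Set} (P? : ∀ x → Dec (P x)) xs →
               sumℚ (map (𝟙 ∘ does ∘ P?) xs) ≡ ℕ→ℚ (length (filter P? xs))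
  sumℚ-map-𝟙 P? []       = refl
  sumℚ-map-𝟙 P? (x ∷ xs) with does (P? x)
  ... | true  = trans (cong (_+_ 1ℚ) (sumℚ-map-𝟙 P? xs)) (sym (ℕ→ℚ-suc (length (filter P? xs))))
  ... | false = trans (ℚP.+-identityˡ _) (sumℚ-map-𝟙 P? xs)

Σ[Fin]-suc : ∀ n (g : Fin (suc n) → ℚ) → Σ[Fin] (suc n) g ≡ g zero + Σ[Fin] n (g ∘ suc)
Σ[Fin]-suc n g = cong (λ xs → g zero + sumℚ xs)
  (trans (ListP.map-tabulate suc g) (sym (ListP.map-tabulate (λ j → j) (g ∘ suc))))

Σ[Fin]-𝟙∈ : ∀ {n} (E : Subset n) → Σ[Fin] n (𝟙 ∘ does ∘ (_∈? E)) ≡ ℕ→ℚ ∣ E ∣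
Σ[Fin]-𝟙∈ []                    = refl
Σ[Fin]-𝟙∈ {suc n} (inside ∷ E)  = trans (Σ[Fin]-suc n (𝟙 ∘ does ∘ (_∈? (inside ∷ E))))
  (trans (cong (_+_ 1ℚ) (Σ[Fin]-𝟙∈ E)) (sym (ℕ→ℚ-suc ∣ E ∣)))
Σ[Fin]-𝟙∈ {suc n} (outside ∷ E) = trans (Σ[Fin]-suc n (𝟙 ∘ does ∘ (_∈? (outside ∷ E))))
  (trans (ℚP.+-identityˡ _) (Σ[Fin]-𝟙∈ E))

Σ[Fin]-δ : ∀ {n} (k : Fin n) a (g : Fin n → ℚ) →
           Σ[Fin] n (λ j → (if does (j ≟ k) then a else 0ℚ) * g j) ≡ a * g k
Σ[Fin]-δ {suc n} zero a g = begin
  Σ[Fin] (suc n) δ                              ≡⟨ Σ[Fin]-suc n δ ⟩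
  a * g zero + Σ[Fin] n (λ j → 0ℚ * g (suc j))  ≡⟨ cong (_+_ (a * g zero)) rest≡0 ⟩
  a * g zero + 0ℚ                               ≡⟨ ℚP.+-identityʳ (a * g zero) ⟩
  a * g zero                                    ∎
  where
  open ≡-Reasoning
  δ : Fin (suc n) → ℚ
  δ j = (if does (j ≟ zero) then a else 0ℚ) * g j
  rest≡0 : Σ[Fin] n (λ j → 0ℚ * g (suc j)) ≡ 0ℚ
  rest≡0 = trans (sumℚ-map-*ˡ 0ℚ (g ∘ suc) (allFin n)) (ℚP.*-zeroˡ (Σ[Fin] n (g ∘ suc)))
Σ[Fin]-δ {suc n} (suc k) a g = begin
  Σ[Fin] (suc n) δ                              ≡⟨ Σ[Fin]-suc n δ ⟩
  0ℚ * g zero + Σ[Fin] n (δ ∘ suc)              ≡⟨ cong (_+ Σ[Fin] n (δ ∘ suc)) (ℚP.*-zeroˡ (g zero)) ⟩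
  0ℚ + Σ[Fin] n (δ ∘ suc)                       ≡⟨ ℚP.+-identityˡ (Σ[Fin] n (δ ∘ suc)) ⟩
  Σ[Fin] n (δ ∘ suc)                            ≡⟨ Σ[Fin]-δ k a (g ∘ suc) ⟩
  a * g (suc k)                                 ∎
  where
  open ≡-Reasoning
  δ : Fin (suc n) → ℚ
  δ j = (if does (j ≟ suc k) then a else 0ℚ) * g j

-- Sherali–Adams products of weights depending only on cardinality

module _ {n} (y : Subset (suc n) → ℚ) (p x : Bool) (P E X : Subset n) where

  altSum-outside : altSum y (p ∷ P) (outside ∷ E) (x ∷ X) ≡ altSum (λ A → y ((p ∨ x) ∷ A)) P E X
  altSum-outside = cong sumℚ (sym (ListP.map-∘ (subsetsOf E)))

  altSum-inside : altSum y (p ∷ P) (inside ∷ E) (x ∷ X)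
                ≡ altSum (λ A → y ((p ∨ x) ∷ A)) P E X - altSum (λ A → y ((p ∨ inside) ∷ A)) P E X
  altSum-inside = begin
    sumℚ (map F (map (outside ∷_) Ts ++ map (inside ∷_) Ts))
      ≡⟨ cong sumℚ (ListP.map-++ F (map (outside ∷_) Ts) (map (inside ∷_) Ts)) ⟩
    sumℚ (map F (map (outside ∷_) Ts) ++ map F (map (inside ∷_) Ts))
      ≡⟨ sumℚ-++ (map F (map (outside ∷_) Ts)) (map F (map (inside ∷_) Ts)) ⟩
    sumℚ (map F (map (outside ∷_) Ts)) + sumℚ (map F (map (inside ∷_) Ts))
      ≡⟨ cong₂ _+_ (cong sumℚ (sym (ListP.map-∘ Ts))) inside-half ⟩
    altSum (λ A → y ((p ∨ x) ∷ A)) P E X - altSum (λ A → y ((p ∨ inside) ∷ A)) P E X ∎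
    where
    open ≡-Reasoning
    Ts : List (Subset n)
    Ts = subsetsOf E
    F : Subset (suc n) → ℚ
    F T = ((- 1ℚ) ^ℚ ∣ T ∣) * y ((p ∷ P) ∪ T ∪ (x ∷ X))
    G : Subset n → ℚ
    G T = ((- 1ℚ) ^ℚ ∣ T ∣) * y ((p ∨ inside) ∷ (P ∪ T ∪ X))
    F[inside∷T]≡-G[T] : ∀ T → F (inside ∷ T) ≡ - G T
    F[inside∷T]≡-G[T] T = solve 2 (λ s w → (:- con 1ℚ :* s) :* w := :- (s :* w)) refl
                                ((- 1ℚ) ^ℚ ∣ T ∣) (y ((p ∨ inside) ∷ (P ∪ T ∪ X)))
    inside-half : sumℚ (map F (map (inside ∷_) Ts)) ≡ - sumℚ (map G Ts)
    inside-half = trans (cong sumℚ (trans (sym (ListP.map-∘ Ts)) (ListP.map-cong F[inside∷T]≡-G[T] Ts)))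
                        (sumℚ-map-neg G Ts)

altSum-overlap : ∀ {n} (y : Subset n → ℚ) (P E X : Subset n) {j} → j ∈ E → j ∈ X → altSum y P E X ≡ 0ℚ
altSum-overlap y (p ∷ P) (inside ∷ E) (inside ∷ X) here here =
  trans (altSum-inside y p inside P E X) (ℚP.+-inverseʳ (altSum (λ A → y ((p ∨ inside) ∷ A)) P E X))
altSum-overlap y (p ∷ P) (outside ∷ E) (x ∷ X) (there j∈E) (there j∈X) =
  trans (altSum-outside y p x P E X) (altSum-overlap (λ A → y ((p ∨ x) ∷ A)) P E X j∈E j∈X)
altSum-overlap y (p ∷ P) (inside ∷ E) (x ∷ X) (there j∈E) (there j∈X) =
  trans (altSum-inside y p x P E X)
    (cong₂ _-_ (altSum-overlap (λ A → y ((p ∨ x) ∷ A)) P E X j∈E j∈X)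
               (altSum-overlap (λ A → y ((p ∨ inside) ∷ A)) P E X j∈E j∈X))

Δ : ℕ → (ℕ → ℚ) → ℕ → ℚ
Δ zero    w c = w c
Δ (suc e) w c = Δ e w c - Δ e w (suc c)

Δ-shift : ∀ e w c → Δ e (w ∘ suc) c ≡ Δ e w (suc c)
Δ-shift zero    w c = refl
Δ-shift (suc e) w c = cong₂ _-_ (Δ-shift e w c) (Δ-shift e w (suc c))

altSum-card : ∀ {n} (w : ℕ → ℚ) (P E X : Subset n) → Empty (P ∩ E) → Empty (X ∩ E) →
              altSum (w ∘ ∣_∣) P E X ≡ Δ (∣ E ∣) w (∣ P ∪ X ∣)
altSum-card w [] [] [] _ _ = trans (ℚP.+-identityʳ _) (ℚP.*-identityˡ (w 0))
altSum-card w (inside ∷ P) (outside ∷ E) (x ∷ X) P∩E≡∅ X∩E≡∅ =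
  trans (altSum-outside (w ∘ ∣_∣) inside x P E X)
    (trans (altSum-card (w ∘ suc) P E X (drop-∷-Empty P∩E≡∅) (drop-∷-Empty X∩E≡∅))
           (Δ-shift ∣ E ∣ w _))
altSum-card w (outside ∷ P) (outside ∷ E) (inside ∷ X) P∩E≡∅ X∩E≡∅ =
  trans (altSum-outside (w ∘ ∣_∣) outside inside P E X)
    (trans (altSum-card (w ∘ suc) P E X (drop-∷-Empty P∩E≡∅) (drop-∷-Empty X∩E≡∅))
           (Δ-shift ∣ E ∣ w _))
altSum-card w (outside ∷ P) (outside ∷ E) (outside ∷ X) P∩E≡∅ X∩E≡∅ =
  trans (altSum-outside (w ∘ ∣_∣) outside outside P E X)
    (altSum-card w P E X (drop-∷-Empty P∩E≡∅) (drop-∷-Empty X∩E≡∅))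
altSum-card w (outside ∷ P) (inside ∷ E) (outside ∷ X) P∩E≡∅ X∩E≡∅ =
  trans (altSum-inside (w ∘ ∣_∣) outside outside P E X)
    (cong₂ _-_ (altSum-card w P E X (drop-∷-Empty P∩E≡∅) (drop-∷-Empty X∩E≡∅))
               (trans (altSum-card (w ∘ suc) P E X (drop-∷-Empty P∩E≡∅) (drop-∷-Empty X∩E≡∅))
                      (Δ-shift ∣ E ∣ w _)))
altSum-card w (inside ∷ P)  (inside ∷ E) X            P∩E≡∅ _     = contradiction (zero , here) P∩E≡∅
altSum-card w (outside ∷ P) (inside ∷ E) (inside ∷ X) _     X∩E≡∅ = contradiction (zero , here) X∩E≡∅

∣p∪⁅x⁆∣≡∣p∣⊎1+∣p∣ : ∀ {n} (p : Subset n) x →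
                    ∣ p ∪ ⁅ x ⁆ ∣ ≡ ∣ p ∣ ⊎ ∣ p ∪ ⁅ x ⁆ ∣ ≡ suc ∣ p ∣
∣p∪⁅x⁆∣≡∣p∣⊎1+∣p∣ (inside ∷ p)  zero    = inj₁ (cong (suc ∘ ∣_∣) (∪-identityʳ p))
∣p∪⁅x⁆∣≡∣p∣⊎1+∣p∣ (outside ∷ p) zero    = inj₂ (cong (suc ∘ ∣_∣) (∪-identityʳ p))
∣p∪⁅x⁆∣≡∣p∣⊎1+∣p∣ (inside ∷ p)  (suc x) = Sum.map (cong suc) (cong suc) (∣p∪⁅x⁆∣≡∣p∣⊎1+∣p∣ p x)
∣p∪⁅x⁆∣≡∣p∣⊎1+∣p∣ (outside ∷ p) (suc x) = ∣p∪⁅x⁆∣≡∣p∣⊎1+∣p∣ p x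

-- Forward differences of the inverse rising factorial

-- invRising m k = 1 / ((m + 1) ⋯ (m + k)); yVec f ℓ A is definitionally invRising (f ∸ ℓ ∸ 1) ∣ A ∣.
invRising : ℕ → ℕ → ℚ
invRising m k = _/_ (+ (m !)) ((m ℕ.+ k) !) {{(m ℕ.+ k) !≢0}}

-- e ∸ 1 is a junk index at e = 0, where it is multiplied by 0.
e*Δ[e∸1] : ∀ e w c → ℕ→ℚ e * (Δ (e ∸ 1) w c - Δ (e ∸ 1) w (suc c)) ≡ ℕ→ℚ e * Δ e w c
e*Δ[e∸1] zero    w c = trans (ℚP.*-zeroˡ (w c - w (suc c))) (sym (ℚP.*-zeroˡ (w c)))
e*Δ[e∸1] (suc e) w c = refl

module _ (m : ℕ) where
  private
    h : ℕ → ℚ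
    h = invRising m

    shift : ∀ g e c → g ℕ.+ e ≡ m ℕ.+ c → suc g ℕ.+ e ≡ m ℕ.+ suc c
    shift g e c eq = trans (cong suc eq) (sym (ℕP.+-suc m c))

  invRising-zero : h 0 ≡ 1ℚ
  invRising-zero =
    trans (ℚP./-cong {+ (m !)} {{(m ℕ.+ 0) !≢0}} {{m !≢0}} refl (cong _! (ℕP.+-identityʳ m)))
          (n/n≡1 (m !) {{m !≢0}})

  invRising-suc : ∀ c → h c ≡ ℕ→ℚ (suc (m ℕ.+ c)) * h (suc c)
  invRising-suc c = trans (i/d≡s*i/[s*d] (+ (m !)) (m ℕ.+ c) ((m ℕ.+ c) !) {{(m ℕ.+ c) !≢0}})
    (cong (ℕ→ℚ (suc (m ℕ.+ c)) *_)
      (ℚP./-cong {+ (m !)} {{ℕP.m*n≢0 (suc (m ℕ.+ c)) ((m ℕ.+ c) !) {{_}} {{(m ℕ.+ c) !≢0}}}}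
                 {{(m ℕ.+ suc c) !≢0}} refl (cong _! (sym (ℕP.+-suc m c)))))

  invRising-nonNeg : ∀ c → 0ℚ ≤ h c
  invRising-nonNeg c = ℚP.nonNegative⁻¹ _ {{ℚP.normalize-nonNeg (m !) ((m ℕ.+ c) !) {{(m ℕ.+ c) !≢0}}}}

  Δ-invRising-recurrence : ∀ e c →
    Δ e h c ≡ ℕ→ℚ (suc (m ℕ.+ c)) * Δ e h (suc c) - ℕ→ℚ e * Δ (e ∸ 1) h (suc (suc c))
  Δ-invRising-recurrence zero c = trans (invRising-suc c)
    (solve 2 (λ a b → a := a :- con 0ℚ :* b) refl (ℕ→ℚ (suc (m ℕ.+ c)) * h (suc c)) (h (suc (suc c))))
  Δ-invRising-recurrence (suc e) c = begin
    Δ e h c - Δ e h (suc c)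
      ≡⟨ cong₂ _-_ (Δ-invRising-recurrence e c) (Δ-invRising-recurrence e (suc c)) ⟩
    (s * A - E * B) - (ℕ→ℚ (suc (m ℕ.+ suc c)) * A′ - E * B′)
      ≡⟨ cong (λ t → (s * A - E * B) - (t * A′ - E * B′)) s′≡1+s ⟩
    (s * A - E * B) - ((1ℚ + s) * A′ - E * B′)
      ≡⟨ solve 6 (λ s E A A′ B B′ → (s :* A :- E :* B) :- ((con 1ℚ :+ s) :* A′ :- E :* B′)
                                 := s :* (A :- A′) :- (A′ :+ E :* (B :- B′))) refl s E A A′ B B′ ⟩
    s * (A - A′) - (A′ + E * (B - B′))
      ≡⟨ cong (λ t → s * (A - A′) - (A′ + t)) (e*Δ[e∸1] e h (suc (suc c))) ⟩
    s * (A - A′) - (A′ + E * A′)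
      ≡⟨ cong (λ t → s * (A - A′) - t) A′+E*A′≡[1+e]*A′ ⟩
    s * (A - A′) - ℕ→ℚ (suc e) * A′ ∎
    where
    open ≡-Reasoning
    s E A A′ B B′ : ℚ
    s  = ℕ→ℚ (suc (m ℕ.+ c))
    E  = ℕ→ℚ e
    A  = Δ e h (suc c)
    A′ = Δ e h (suc (suc c))
    B  = Δ (e ∸ 1) h (suc (suc c))
    B′ = Δ (e ∸ 1) h (suc (suc (suc c)))
    s′≡1+s : ℕ→ℚ (suc (m ℕ.+ suc c)) ≡ 1ℚ + s
    s′≡1+s = trans (cong (ℕ→ℚ ∘ suc) (ℕP.+-suc m c)) (ℕ→ℚ-suc (suc (m ℕ.+ c)))
    A′+E*A′≡[1+e]*A′ : A′ + E * A′ ≡ ℕ→ℚ (suc e) * A′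
    A′+E*A′≡[1+e]*A′ = trans (solve 2 (λ E A → A :+ E :* A := (con 1ℚ :+ E) :* A) refl E A′)
                             (cong (_* A′) (sym (ℕ→ℚ-suc e)))

  Δ-invRising-suc : ∀ e c g → g ℕ.+ e ≡ m ℕ.+ c →
    Δ (suc e) h c ≡ ℕ→ℚ g * Δ e h (suc c) + ℕ→ℚ e * (Δ e h (suc c) - Δ (e ∸ 1) h (suc (suc c)))
  Δ-invRising-suc e c g g+e≡m+c = begin
    Δ e h c - X                            ≡⟨ cong (λ t → t - X) (Δ-invRising-recurrence e c) ⟩
    (ℕ→ℚ (suc (m ℕ.+ c)) * X - E * Y) - X  ≡⟨ cong (λ t → (t * X - E * Y) - X) s≡1+g+e ⟩
    ((1ℚ + (G + E)) * X - E * Y) - X       ≡⟨ solve 4 (λ G E X Y → ((con 1ℚ :+ (G :+ E)) :* X :- E :* Y) :- X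
                                                              := G :* X :+ E :* (X :- Y)) refl G E X Y ⟩
    G * X + E * (X - Y)                    ∎
    where
    open ≡-Reasoning
    G E X Y : ℚ
    G = ℕ→ℚ g
    E = ℕ→ℚ e
    X = Δ e h (suc c)
    Y = Δ (e ∸ 1) h (suc (suc c))
    s≡1+g+e : ℕ→ℚ (suc (m ℕ.+ c)) ≡ 1ℚ + (G + E)
    s≡1+g+e = trans (ℕ→ℚ-suc (m ℕ.+ c)) (cong (_+_ 1ℚ) (trans (cong ℕ→ℚ (sym g+e≡m+c)) (ℕ→ℚ-+ g e)))

  Δ-invRising-suc-≥ : ∀ e c g → g ℕ.+ e ≡ m ℕ.+ c →
    0ℚ ≤ ℕ→ℚ e * (Δ e h (suc c) - Δ (e ∸ 1) h (suc (suc c))) → ℕ→ℚ g * Δ e h (suc c) ≤ Δ (suc e) h c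
  Δ-invRising-suc-≥ e c g g+e≡m+c 0≤e*[X-Y] =
    subst (ℕ→ℚ g * Δ e h (suc c) ≤_) (sym (Δ-invRising-suc e c g g+e≡m+c)) (p≤p+q 0≤e*[X-Y])

  -- Nonnegativity alone is not inductive; the graded lower bound is what the recurrence propagates.
  Δ-invRising-graded : ∀ e c g → g ℕ.+ e ≡ m ℕ.+ c →
    0ℚ ≤ Δ e h c × ℕ→ℚ g * Δ e h (suc c) ≤ Δ (suc e) h c
  Δ-invRising-graded zero c g g+0≡m+c =
    invRising-nonNeg c ,
    Δ-invRising-suc-≥ 0 c g g+0≡m+c (ℚP.≤-reflexive (sym (ℚP.*-zeroˡ (h (suc c) - h (suc (suc c))))))
  Δ-invRising-graded (suc e) c g g+1+e≡m+c =
    ℚP.≤-trans (0≤* (ℕ→ℚ-nonNeg (suc g)) (proj₁ IH₁)) (proj₂ IH₀) ,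
    Δ-invRising-suc-≥ (suc e) c g g+1+e≡m+c (0≤* (ℕ→ℚ-nonNeg (suc e)) (0≤q-p Y≤X))
    where
    eq₀ : suc g ℕ.+ e ≡ m ℕ.+ c
    eq₀ = trans (sym (ℕP.+-suc g e)) g+1+e≡m+c
    eq₁ : suc (suc g) ℕ.+ e ≡ m ℕ.+ suc c
    eq₁ = shift (suc g) e c eq₀
    IH₀ = Δ-invRising-graded e c (suc g) eq₀
    IH₁ = Δ-invRising-graded e (suc c) (suc (suc g)) eq₁
    IH₂ = Δ-invRising-graded e (suc (suc c)) (suc (suc (suc g))) (shift (suc (suc g)) e (suc c) eq₁)
    Y≤X : Δ e h (suc (suc c)) ≤ Δ (suc e) h (suc c)
    Y≤X = ℚP.≤-trans (p≤[1+k]*p (suc g) (proj₁ IH₂)) (proj₂ IH₁)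

  Δ-invRising-nonNeg : ∀ e c → e ℕ.≤ suc (m ℕ.+ c) → 0ℚ ≤ Δ e h c
  Δ-invRising-nonNeg zero    c _             = invRising-nonNeg c
  Δ-invRising-nonNeg (suc e) c (ℕ.s≤s e≤m+c) = ℚP.≤-trans
    (0≤* (ℕ→ℚ-nonNeg g) (proj₁ (Δ-invRising-graded e (suc c) (suc g) (shift g e c g+e≡m+c))))
    (proj₂ (Δ-invRising-graded e c g g+e≡m+c))
    where
    g = m ℕ.+ c ∸ e
    g+e≡m+c : g ℕ.+ e ≡ m ℕ.+ c
    g+e≡m+c = ℕP.m∸n+n≡m e≤m+c

  Δ-invRising-≤ : ∀ e c f → e ℕ.≤ suc (m ℕ.+ c) → suc (m ℕ.+ c) ℕ.+ e ℕ.≤ f →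
    Δ e h c ≤ ℕ→ℚ f * Δ e h (suc c) - ℕ→ℚ e * Δ e h (suc c)
  Δ-invRising-≤ e c f e≤1+m+c 1+m+c+e≤f =
    subst (_≤ F * X - E * X) (sym (Δ-invRising-recurrence e c))
      (≤-from-difference (R * X + E * Y) difference
                         (0≤+ (0≤* (ℕ→ℚ-nonNeg r) 0≤X) (0≤* (ℕ→ℚ-nonNeg e) 0≤Y)))
    where
    r = f ∸ (suc (m ℕ.+ c) ℕ.+ e)
    F S E R X Y : ℚ
    F = ℕ→ℚ f
    S = ℕ→ℚ (suc (m ℕ.+ c))
    E = ℕ→ℚ e
    R = ℕ→ℚ r
    X = Δ e h (suc c)
    Y = Δ (e ∸ 1) h (suc (suc c))
    F≡R+S+E : F ≡ R + (S + E)
    F≡R+S+E = trans (cong ℕ→ℚ (sym (ℕP.m∸n+n≡m 1+m+c+e≤f)))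
                    (trans (ℕ→ℚ-+ r _) (cong (_+_ R) (ℕ→ℚ-+ (suc (m ℕ.+ c)) e)))
    difference : (F * X - E * X) - (S * X - E * Y) ≡ R * X + E * Y
    difference = trans (cong (λ t → (t * X - E * X) - (S * X - E * Y)) F≡R+S+E)
      (solve 5 (λ R S E X Y → ((R :+ (S :+ E)) :* X :- E :* X) :- (S :* X :- E :* Y) := R :* X :+ E :* Y)
             refl R S E X Y)
    1+m+c≤1+m+[k+c] : ∀ k → suc (m ℕ.+ c) ℕ.≤ suc (m ℕ.+ (k ℕ.+ c))
    1+m+c≤1+m+[k+c] k = ℕ.s≤s (ℕP.+-monoʳ-≤ m (ℕP.m≤n+m c k))
    0≤X : 0ℚ ≤ X
    0≤X = Δ-invRising-nonNeg e (suc c) (ℕP.≤-trans e≤1+m+c (1+m+c≤1+m+[k+c] 1))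
    0≤Y : 0ℚ ≤ Y
    0≤Y = Δ-invRising-nonNeg (e ∸ 1) (suc (suc c))
            (ℕP.≤-trans (ℕP.m∸n≤m e 1) (ℕP.≤-trans e≤1+m+c (1+m+c≤1+m+[k+c] 2)))

-- The Sherali–Adams constraints

module _ {n} (m ℓ : ℕ) (ℓ≤m : ℓ ℕ.≤ m)
         (P E : Subset n) (P∩E≡∅ : Empty (P ∩ E)) (p+e≤ℓ : ∣ P ∣ ℕ.+ ∣ E ∣ ℕ.≤ ℓ) where
  private
    p e : ℕ
    p = ∣ P ∣
    e = ∣ E ∣

    e≤m+p : e ℕ.≤ m ℕ.+ p
    e≤m+p = ℕP.≤-trans (ℕP.m≤n+m e p) (ℕP.≤-trans p+e≤ℓ (ℕP.≤-trans ℓ≤m (ℕP.m≤m+n m p)))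

    y : Subset n → ℚ
    y = invRising m ∘ ∣_∣

    v : Fin n → ℚ
    v j = altSum y P E ⁅ j ⁆

    D X : ℚ
    D = Δ e (invRising m) p
    X = Δ e (invRising m) (suc p)

    altSum-⊥ : altSum y P E ⊥ ≡ D
    altSum-⊥ = trans (altSum-card (invRising m) P E ⊥ P∩E≡∅ ⊥∩E≡∅)
                     (cong (Δ e (invRising m) ∘ ∣_∣) (∪-identityʳ P))
      where
      ⊥∩E≡∅ : Empty (⊥ ∩ E)
      ⊥∩E≡∅ (x , x∈⊥∩E) = ∉⊥ (proj₁ (x∈p∩q⁻ ⊥ E x∈⊥∩E))

    0≤D : 0ℚ ≤ D
    0≤D = Δ-invRising-nonNeg m e p (ℕP.m≤n⇒m≤1+n e≤m+p)

    0≤X : 0ℚ ≤ X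
    0≤X = Δ-invRising-nonNeg m e (suc p)
            (ℕP.m≤n⇒m≤1+n (ℕP.≤-trans e≤m+p (ℕP.+-monoʳ-≤ m (ℕP.n≤1+n p))))

    X≤D : X ≤ D
    X≤D = ≤-from-difference (D - X) refl (Δ-invRising-nonNeg m (suc e) p (ℕ.s≤s e≤m+p))

    v≡D⊎v≡X : ∀ j → j ∉ E → v j ≡ D ⊎ v j ≡ X
    v≡D⊎v≡X j j∉E = Sum.map (trans v≡ ∘ cong (Δ e (invRising m))) (trans v≡ ∘ cong (Δ e (invRising m)))
                              (∣p∪⁅x⁆∣≡∣p∣⊎1+∣p∣ P j)
      where
      ⁅j⁆∩E≡∅ : Empty (⁅ j ⁆ ∩ E)
      ⁅j⁆∩E≡∅ (x , x∈⁅j⁆∩E) with x∈p∩q⁻ ⁅ j ⁆ E x∈⁅j⁆∩E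
      ... | x∈⁅j⁆ , x∈E = j∉E (subst (_∈ E) (x∈⁅y⁆⇒x≡y j x∈⁅j⁆) x∈E)
      v≡ : v j ≡ Δ e (invRising m) ∣ P ∪ ⁅ j ⁆ ∣
      v≡ = altSum-card (invRising m) P E ⁅ j ⁆ P∩E≡∅ ⁅j⁆∩E≡∅

    0≤v≤D : ∀ j → Dec (j ∈ E) → 0ℚ ≤ v j × v j ≤ D
    0≤v≤D j (yes j∈E) = subst (0ℚ ≤_) (sym v≡0) ℚP.≤-refl , subst (_≤ D) (sym v≡0) 0≤D
      where
      v≡0 : v j ≡ 0ℚ
      v≡0 = altSum-overlap y P E ⁅ j ⁆ j∈E (x∈⁅x⁆ j)
    0≤v≤D j (no j∉E) = Sum.[ (λ v≡D → subst (0ℚ ≤_) (sym v≡D) 0≤D , ℚP.≤-reflexive v≡D)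
                           , (λ v≡X → subst (0ℚ ≤_) (sym v≡X) 0≤X , subst (_≤ D) (sym v≡X) X≤D)
                           ]′ (v≡D⊎v≡X j j∉E)

    X≤v : ∀ j → j ∉ E → X ≤ v j
    X≤v j j∉E = Sum.[ (λ v≡D → subst (X ≤_) (sym v≡D) X≤D)
                    , (λ v≡X → ℚP.≤-reflexive (sym v≡X))
                    ]′ (v≡D⊎v≡X j j∉E)

    𝟙*X-𝟙∈E*X≤𝟙*v : ∀ b j (j∈?E : Dec (j ∈ E)) → 𝟙 b * X - 𝟙 (does j∈?E) * X ≤ 𝟙 b * v j
    𝟙*X-𝟙∈E*X≤𝟙*v false j (yes _)   = ≤-from-difference X
      (solve 2 (λ x w → con 0ℚ :* w :- (con 0ℚ :* x :- con 1ℚ :* x) := x) refl X (v j)) 0≤X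
    𝟙*X-𝟙∈E*X≤𝟙*v false j (no _)    = ≤-from-difference 0ℚ
      (solve 2 (λ x w → con 0ℚ :* w :- (con 0ℚ :* x :- con 0ℚ :* x) := con 0ℚ) refl X (v j)) ℚP.≤-refl
    𝟙*X-𝟙∈E*X≤𝟙*v true  j (yes j∈E) = ≤-from-difference (v j)
      (solve 2 (λ x w → con 1ℚ :* w :- (con 1ℚ :* x :- con 1ℚ :* x) := w) refl X (v j))
      (proj₁ (0≤v≤D j (yes j∈E)))
    𝟙*X-𝟙∈E*X≤𝟙*v true  j (no j∉E)  = ≤-from-difference (v j - X)
      (solve 2 (λ x w → con 1ℚ :* w :- (con 1ℚ :* x :- con 0ℚ :* x) := w :- x) refl X (v j))
      (0≤q-p (X≤v j j∉E))

  SA-lower : ∀ k → 0ℚ * altSum y P E ⊥ ≤ Σ[Fin] n (λ j → 𝟙 (does (j ≟ k)) * v j)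
  SA-lower k = begin
    0ℚ * altSum y P E ⊥                      ≡⟨ ℚP.*-zeroˡ (altSum y P E ⊥) ⟩
    0ℚ                                       ≤⟨ proj₁ (0≤v≤D k (k ∈? E)) ⟩
    v k                                      ≡⟨ sym (ℚP.*-identityˡ (v k)) ⟩
    1ℚ * v k                                 ≡⟨ sym (Σ[Fin]-δ k 1ℚ v) ⟩
    Σ[Fin] n (λ j → 𝟙 (does (j ≟ k)) * v j)  ∎
    where open ℚP.≤-Reasoning

  SA-upper : ∀ k → (- 1ℚ) * altSum y P E ⊥ ≤ Σ[Fin] n (λ j → (if does (j ≟ k) then - 1ℚ else 0ℚ) * v j)
  SA-upper k = begin
    (- 1ℚ) * altSum y P E ⊥                                     ≡⟨ cong (_*_ (- 1ℚ)) altSum-⊥ ⟩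
    (- 1ℚ) * D                                                  ≤⟨ ℚP.*-monoˡ-≤-nonPos (- 1ℚ)
                                                                                         (proj₂ (0≤v≤D k (k ∈? E))) ⟩
    (- 1ℚ) * v k                                                ≡⟨ sym (Σ[Fin]-δ k (- 1ℚ) v) ⟩
    Σ[Fin] n (λ j → (if does (j ≟ k) then - 1ℚ else 0ℚ) * v j)  ∎
    where open ℚP.≤-Reasoning

  SA-cover : ∀ (S : SetCoverInstance n) u → frequency S u ≡ suc (m ℕ.+ ℓ) →
             1ℚ * altSum y P E ⊥ ≤ Σ[Fin] n (λ j → 𝟙 (does (u ∈? S j)) * v j)
  SA-cover S u freq≡f = begin
    1ℚ * altSum y P E ⊥                  ≡⟨ trans (ℚP.*-identityˡ (altSum y P E ⊥)) altSum-⊥ ⟩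
    D                                    ≤⟨ Δ-invRising-≤ m e p f (ℕP.m≤n⇒m≤1+n e≤m+p) 1+m+p+e≤f ⟩
    ℕ→ℚ f * X - ℕ→ℚ e * X                ≡⟨ sym (cong₂ _-_ Σ𝟙u*X≡f*X Σ𝟙E*X≡e*X) ⟩
    Σ[Fin] n 𝟙u*X - Σ[Fin] n 𝟙E*X        ≡⟨ sym (sumℚ-map-- 𝟙u*X 𝟙E*X (allFin n)) ⟩
    Σ[Fin] n (λ j → 𝟙u*X j - 𝟙E*X j)     ≤⟨ sumℚ-map-mono (λ j → 𝟙*X-𝟙∈E*X≤𝟙*v (does (u ∈? S j)) j (j ∈? E))
                                                          (allFin n) ⟩
    Σ[Fin] n (λ j → 𝟙 (does (u ∈? S j)) * v j) ∎
    where
    open ℚP.≤-Reasoning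
    f = suc (m ℕ.+ ℓ)
    1+m+p+e≤f : suc (m ℕ.+ p) ℕ.+ e ℕ.≤ f
    1+m+p+e≤f = ℕ.s≤s (ℕP.≤-trans (ℕP.≤-reflexive (ℕP.+-assoc m p e)) (ℕP.+-monoʳ-≤ m p+e≤ℓ))
    𝟙u*X 𝟙E*X : Fin n → ℚ
    𝟙u*X j = 𝟙 (does (u ∈? S j)) * X
    𝟙E*X j = 𝟙 (does (j ∈? E)) * X
    Σ𝟙u*X≡f*X : Σ[Fin] n 𝟙u*X ≡ ℕ→ℚ f * X
    Σ𝟙u*X≡f*X = trans (sumℚ-map-*ʳ X (𝟙 ∘ does ∘ (u ∈?_) ∘ S) (allFin n))
      (cong (_* X) (trans (sumℚ-map-𝟙 (λ j → u ∈? S j) (allFin n)) (cong ℕ→ℚ freq≡f)))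
    Σ𝟙E*X≡e*X : Σ[Fin] n 𝟙E*X ≡ ℕ→ℚ e * X
    Σ𝟙E*X≡e*X = trans (sumℚ-map-*ʳ X (𝟙 ∘ does ∘ (_∈? E)) (allFin n)) (cong (_* X) (Σ[Fin]-𝟙∈ E))

SA-setCover : ∀ {n} (S : SetCoverInstance n) m ℓ → ℓ ℕ.≤ m → (∀ u → frequency S u ≡ suc (m ℕ.+ ℓ)) →
  ∀ i (P E : Subset n) → Disjoint P E → ∣ P ∣ ℕ.+ ∣ E ∣ ℕ.≤ ℓ →
  Constraint.rhs (setCoverConstraints S i) * altSum (invRising m ∘ ∣_∣) P E ⊥
    ≤ Σ[Fin] n (λ j → Constraint.coeff (setCoverConstraints S i) j
                        * altSum (invRising m ∘ ∣_∣) P E ⁅ j ⁆)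
SA-setCover S m ℓ ℓ≤m freq (cover u) P E P∩E≡∅ p+e≤ℓ = SA-cover m ℓ ℓ≤m P E P∩E≡∅ p+e≤ℓ S u (freq u)
SA-setCover S m ℓ ℓ≤m freq (lower k) P E P∩E≡∅ p+e≤ℓ = SA-lower m ℓ ℓ≤m P E P∩E≡∅ p+e≤ℓ k
SA-setCover S m ℓ ℓ≤m freq (upper k) P E P∩E≡∅ p+e≤ℓ = SA-upper m ℓ ℓ≤m P E P∩E≡∅ p+e≤ℓ k

positive-frequency : ∀ {n} f {ε η} → η < ε → ℕ→ℚ f ≡ (ε - η) * ℕ→ℚ n → Fin n → 0 ℕ.< f
positive-frequency (suc f) _ _ _ = ℕ.s≤s ℕ.z≤n
positive-frequency {suc n} zero {ε} {η} η<ε 0≡[ε-η]n _ = contradiction 0≡[ε-η]n (ℚP.<⇒≢ 0<[ε-η]n)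
  where
  0<ε-η : 0ℚ < ε - η
  0<ε-η = subst (_< ε - η) (ℚP.+-inverseʳ η) (ℚP.+-monoˡ-< (- η) η<ε)
  0<[ε-η]n : 0ℚ < (ε - η) * ℕ→ℚ (suc n)
  0<[ε-η]n = ℚP.positive⁻¹ _
    {{ℚP.pos*pos⇒pos (ε - η) {{ℚ.positive 0<ε-η}} (ℕ→ℚ (suc n)) {{ℚP.normalize-pos (suc n) 1}}}}

2ℓ<f : ∀ ℓ {f} → 0 ℕ.< f → 3 ℕ.* ℓ ℕ.≤ f → 2 ℕ.* ℓ ℕ.< f
2ℓ<f zero    0<f _    = 0<f
2ℓ<f (suc ℓ) _   3ℓ≤f = ℕP.<-≤-trans (ℕP.*-monoˡ-< (suc ℓ) (ℕP.n<1+n 2)) 3ℓ≤f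

f∸ℓ∸1-bounds : ∀ ℓ {f} → 2 ℕ.* ℓ ℕ.< f → ℓ ℕ.≤ f ∸ ℓ ∸ 1 × f ≡ suc (f ∸ ℓ ∸ 1 ℕ.+ ℓ)
f∸ℓ∸1-bounds ℓ {f} 2ℓ<f = subst (ℓ ℕ.≤_) (sym m≡f∸[1+ℓ]) (ℕP.m+n≤o⇒m≤o∸n ℓ ℓ+[1+ℓ]≤f) , f≡1+m+ℓ
  where
  m = f ∸ ℓ ∸ 1
  m≡f∸[1+ℓ] : m ≡ f ∸ suc ℓ
  m≡f∸[1+ℓ] = trans (ℕP.∸-+-assoc f ℓ 1) (cong (f ∸_) (ℕP.+-comm ℓ 1))
  ℓ+[1+ℓ]≤f : ℓ ℕ.+ suc ℓ ℕ.≤ f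
  ℓ+[1+ℓ]≤f = subst (ℕ._≤ f)
    (trans (cong (λ t → suc (ℓ ℕ.+ t)) (ℕP.+-identityʳ ℓ)) (sym (ℕP.+-suc ℓ ℓ))) 2ℓ<f
  f≡1+m+ℓ : f ≡ suc (m ℕ.+ ℓ)
  f≡1+m+ℓ = sym (trans (sym (ℕP.+-suc m ℓ)) (trans (cong (ℕ._+ suc ℓ) m≡f∸[1+ℓ])
    (ℕP.m∸n+n≡m (ℕP.≤-trans (ℕP.m≤n+m (suc ℓ) ℓ) ℓ+[1+ℓ]≤f))))

universe-element : ∀ {n} → SCIndex n → Fin n
universe-element (cover u) = u
universe-element (lower k) = k
universe-element (upper k) = k

lemma3 : (n : ℕ) (S : SetCoverInstance n) (ε η : ℚ) (f ℓ : ℕ) →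
    0ℚ < η → η < ε →
    ℕ→ℚ f ≡ (ε - η) * ℕ→ℚ n →
    (∀ u → frequency S u ≡ f) →
    (∀ (C : Subset n) → IsCover S C → ℕ→ℚ n ≤ (1ℚ + ε) ^ℚ ∣ C ∣) →
    3 ℕ.* ℓ ℕ.≤ f →
    SA-feasible ℓ (setCoverConstraints S) (yVec {n} f ℓ)
lemma3 n S ε η f ℓ _ η<ε f≡[ε-η]n freq _ 3ℓ≤f =
  trans (cong (invRising m) (∣⊥∣≡0 n)) (invRising-zero m) ,
  λ i → let ℓ≤m , f≡1+m+ℓ = bounds i in SA-setCover S m ℓ ℓ≤m (λ u → trans (freq u) f≡1+m+ℓ) i
  where
  m = f ∸ ℓ ∸ 1
  bounds : SCIndex n → ℓ ℕ.≤ m × f ≡ suc (m ℕ.+ ℓ)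
  bounds i = f∸ℓ∸1-bounds ℓ (2ℓ<f ℓ (positive-frequency f η<ε f≡[ε-η]n (universe-element i)) 3ℓ≤f)
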